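{- Let $D=(E,\mathcal{F})$ be a set system. Then for every $\bullet\in\mathcal{B}$, ${}^{\partial}w_{D}^{*\bullet*}(z)={}^{\partial}w_{D^{*}}^{\bullet}(z)$.
   Context: A set system is a pair $D=(E,\mathcal{F})$ with $E$ finite and $\mathcal{F}$ a collection of subsets of $E$. The width $w(D)$ is the maximum size minus the minimum size of a feasible set. For $A\subseteq E$, $D^{*|A}=(E,\{A\Delta X:X\in\mathcal{F}\})$ and $D^*=D^{*|E}$. For $e\in E$, $D^{\times|e}=(E,\mathcal{F}\Delta\{F\cup e:F\in\mathcal{F},e\notin F\})$. For a word $a=a_1\cdots a_n$ in $\{*,\times\}$, $D^{a|e}$ means applying $a_1|e$, then $a_2|e$, etc.; $D^{a|A}$ for $A=\{e_1,\dots,e_m\}$ means applying $a|e_1,\dots,a|e_m$ in turn. These give an action of $\mathcal{B}=\langle *,\times\mid *^2,\times^2,(*\times)^3\rangle\cong S_3$; $*\bullet*$ denotes the word $*$ followed by $\bullet$ followed by $*$. The partial-$\bullet$ polynomial is ${}^{\partial}w_{D}^{\bullet}(z)=\sum_{A\subseteq E}z^{w(D^{\bullet|A})}$. -}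

module Defs where

open import Data.Nat using (ℕ; zero; suc; _∸_; _⊔_; _⊓_)
open import Data.Bool using (Bool; true; false; _xor_; _∧_; if_then_else_)
open import Data.Fin using (Fin)
open import Data.Vec using (Vec; []; _∷_; lookup; zipWith; map)
open import Data.Fin.Subset using (Subset; ∣_∣; _-_)
open import Data.List as L using (List; []; _∷_; _++_; filter; length; foldl)
open import Data.Maybe using (Maybe; just; nothing)
open import Relation.Binary.PropositionalEquality using (_≡_)

-- The collection 𝓕 of subsets
-- is given by its characteristic function on subsets (so it is a genuine set
-- of subsets, and symmetric differences of collections are xor).
record SetSystem (n : ℕ) : Set where
  constructor mkSS
  field
    feasible : Subset n → Bool
open SetSystem public

allSubsets : (n : ℕ) → List (Subset n)
allSubsets zero = [] ∷ []
allSubsets (suc n) = L.map (true ∷_) (allSubsets n) ++ L.map (false ∷_) (allSubsets n)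

_Δ_ : ∀ {n} → Subset n → Subset n → Subset n
A Δ B = zipWith _xor_ A B

feasibleSizes : ∀ {n} → SetSystem n → List ℕ
feasibleSizes {n} D = L.map ∣_∣ (filter (λ X → feasible D X Data.Bool.≟ true) (allSubsets n))

maxL : List ℕ → ℕ
maxL = L.foldr _⊔_ 0

minL : List ℕ → Maybe ℕ
minL [] = nothing
minL (x ∷ xs) = just (L.foldr _⊓_ x xs)

-- width: max size minus min size of a feasible set
-- (convention: 0 for the empty collection)
width : ∀ {n} → SetSystem n → ℕ
width D with minL (feasibleSizes D)
... | nothing = 0
... | just m = maxL (feasibleSizes D) ∸ m

-- partial dual with respect to A:  𝓕 ↦ { A Δ X : X ∈ 𝓕 }
dualAt : ∀ {n} → Subset n → SetSystem n → SetSystem n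
feasible (dualAt A D) Y = feasible D (A Δ Y)

dual : ∀ {n} → SetSystem n → SetSystem n
dual {n} D = dualAt (Data.Vec.replicate n true) D

single : ∀ {n} → Fin n → Subset n
single {n} e = Data.Fin.Subset.⁅_⁆ e

-- twist at e:  𝓕 Δ { F ∪ e : F ∈ 𝓕, e ∉ F }.
-- Y lies in the second collection iff e ∈ Y and Y - e ∈ 𝓕.
twistAt : ∀ {n} → Fin n → SetSystem n → SetSystem n
feasible (twistAt e D) Y = feasible D Y xor (lookup Y e ∧ feasible D (Y - e))

-- letters and words of the ribbon group 𝓑 = ⟨ *, × ⟩
data Letter : Set where
  star times : Letter

Word : Set
Word = List Letter

applyLetter : ∀ {n} → Letter → Fin n → SetSystem n → SetSystem n
applyLetter star  e D = dualAt (single e) D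
applyLetter times e D = twistAt e D

applyWordAt : ∀ {n} → Word → Fin n → SetSystem n → SetSystem n
applyWordAt w e D = foldl (λ D' l → applyLetter l e D') D w

elems : ∀ {n} → Subset n → List (Fin n)
elems [] = []
elems (true ∷ A) = Data.Fin.zero ∷ L.map Data.Fin.suc (elems A)
elems (false ∷ A) = L.map Data.Fin.suc (elems A)

applyWord : ∀ {n} → Word → Subset n → SetSystem n → SetSystem n
applyWord w A D = foldl (λ D' e → applyWordAt w e D') D (elems A)

-- the partial-• polynomial  Σ_{A ⊆ E} z^{w(D^{•|A})}, represented by its
-- coefficient sequence: coefficient of z^k
partialPoly : ∀ {n} → SetSystem n → Word → ℕ → ℕ
partialPoly {n} D w k =
  length (filter (λ A → width (applyWord w A D) Data.Nat.≟ k) (allSubsets n))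

conjStar : Word → Word
conjStar w = star ∷ (w ++ (star ∷ []))

module Submission where

-- Partial duals compose by symmetric difference, so the full dual is the
-- partial dual at {e} followed by the one at E - e.  The latter does not touch
-- e and therefore commutes with both * and × applied at e; the two partial
-- duals at {e} then absorb the outer stars of * • *, giving
-- (D^{*•*|e})^* = (D^*)^{•|e}, and iterating over the elements of A gives
-- (D^{*•*|A})^* = (D^*)^{•|A}.  Finally the full dual sends a feasible set of
-- size s to one of size |E| - s, so it preserves the width.

open import Defs
open import Data.Nat using (ℕ; suc; _+_; _≤_; _∸_; _⊓_)
open import Data.Nat.Properties
  using (≤-refl; ≤-trans; ≤-antisym; m≤m⊔n; m≤n⊔m; m⊓n≤m; m⊓n≤n; ⊔-sel; ⊓-sel; ⊔-identityʳ;
         ∸-monoʳ-≤; +-∸-assoc; m+n∸m≡n; m∸n+n≡m; m∸[m∸n]≡n)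
open import Data.Bool using (true; false; _xor_; _∧_; _≟_)
open import Data.Bool.Properties using (xor-assoc; xor-comm; xor-same; xor-identityˡ)
open import Data.Fin using (Fin)
open import Data.Fin.Subset using (Subset; ⊥; ⊤; _-_; ∣_∣)
open import Data.Fin.Subset.Properties using (x∈⁅x⁆; p─⊥≡p; ∣p∣≤n)
open import Data.Vec using ([]; _∷_; lookup)
open import Data.Vec.Properties
  using (zipWith-assoc; zipWith-comm; zipWith-identityˡ; lookup-zipWith; lookup-replicate; []=⇒lookup)
open import Data.List as L using (List; []; _∷_; foldl)
open import Data.List.Properties using (foldl-++; filter-≐)
open import Data.List.Membership.Propositional using (_∈_)
open import Data.List.Membership.Propositional.Properties
  using (∈-++⁺ˡ; ∈-++⁺ʳ; ∈-map⁺; ∈-map∘filter⁻; ∈-map∘filter⁺)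
open import Data.List.Relation.Unary.Any using (here; there)
open import Data.Maybe using (just; nothing)
open import Data.Product using (∃-syntax; _×_; _,_)
open import Data.Sum using (inj₁; inj₂)
open import Function using (case_of_)
open import Relation.Binary.Bundles using (Setoid)
open import Relation.Binary.PropositionalEquality
import Relation.Binary.Reasoning.Setoid as SetoidReasoning
open import Relation.Unary using (_≐_)

private
  variable
    n : ℕ

Δ-assoc : (A B C : Subset n) → (A Δ B) Δ C ≡ A Δ (B Δ C)
Δ-assoc = zipWith-assoc xor-assoc

Δ-comm : (A B : Subset n) → A Δ B ≡ B Δ A
Δ-comm = zipWith-comm xor-comm

Δ-self : (A : Subset n) → A Δ A ≡ ⊥
Δ-self [] = refl
Δ-self (a ∷ A) = cong₂ _∷_ (xor-same a) (Δ-self A)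

Δ-cancelˡ : (A Y : Subset n) → A Δ (A Δ Y) ≡ Y
Δ-cancelˡ A Y = begin
  A Δ (A Δ Y) ≡⟨ Δ-assoc A A Y ⟨
  (A Δ A) Δ Y ≡⟨ cong (_Δ Y) (Δ-self A) ⟩
  ⊥ Δ Y       ≡⟨ zipWith-identityˡ xor-identityˡ Y ⟩
  Y           ∎
  where open ≡-Reasoning

lookup-Δ-∉ : (e : Fin n) (X Y : Subset n) → lookup X e ≡ false → lookup (X Δ Y) e ≡ lookup Y e
lookup-Δ-∉ Fin.zero    (false ∷ X) (y ∷ Y) refl = refl
lookup-Δ-∉ (Fin.suc e) (x ∷ X)     (y ∷ Y) e∉X  = lookup-Δ-∉ e X Y e∉X

Δ-remove-∉ : (e : Fin n) (X Y : Subset n) → lookup X e ≡ false → X Δ (Y - e) ≡ (X Δ Y) - e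
Δ-remove-∉ Fin.zero    (false ∷ X) (y ∷ Y) refl =
  cong (false ∷_) (trans (cong (X Δ_) (p─⊥≡p Y)) (sym (p─⊥≡p (X Δ Y))))
Δ-remove-∉ (Fin.suc e) (x ∷ X)     (y ∷ Y) e∉X  = cong ((x xor y) ∷_) (Δ-remove-∉ e X Y e∉X)

infix 4 _≈_

_≈_ : SetSystem n → SetSystem n → Set
D ≈ D' = ∀ Y → feasible D Y ≡ feasible D' Y

≈-setoid : ℕ → Setoid _ _
≈-setoid n = record
  { Carrier       = SetSystem n
  ; _≈_           = _≈_
  ; isEquivalence = record
    { refl  = λ _ → refl
    ; sym   = λ p Y → sym (p Y)
    ; trans = λ p q Y → trans (p Y) (q Y)
    }
  }

Congruent : (SetSystem n → SetSystem n) → Set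
Congruent φ = ∀ {D D'} → D ≈ D' → φ D ≈ φ D'

dualAt-cong : (A : Subset n) → Congruent (dualAt A)
dualAt-cong A p Y = p (A Δ Y)

twistAt-cong : (e : Fin n) → Congruent (twistAt e)
twistAt-cong e p Y = cong₂ (λ a b → a xor (lookup Y e ∧ b)) (p Y) (p (Y - e))

applyLetter-cong : (l : Letter) (e : Fin n) → Congruent (applyLetter l e)
applyLetter-cong star  e = dualAt-cong (single e)
applyLetter-cong times e = twistAt-cong e

module _ {a} {X : Set a} where

  foldl-cong : (f : SetSystem n → X → SetSystem n) → (∀ x → Congruent (λ D → f D x)) →
               ∀ xs → Congruent (λ D → foldl f D xs)
  foldl-cong f f-cong []       p = p
  foldl-cong f f-cong (x ∷ xs) p = foldl-cong f f-cong xs (f-cong x p)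

  foldl-intertwine : (h : SetSystem n → SetSystem n) (f g : SetSystem n → X → SetSystem n) →
                     (∀ x → Congruent (λ D → g D x)) → (∀ x D → h (f D x) ≈ g (h D) x) →
                     ∀ xs D → h (foldl f D xs) ≈ foldl g (h D) xs
  foldl-intertwine h f g g-cong comm []       D Y = refl
  foldl-intertwine h f g g-cong comm (x ∷ xs) D Y =
    trans (foldl-intertwine h f g g-cong comm xs (f D x) Y) (foldl-cong g g-cong xs (comm x D) Y)

applyWordAt-cong : (w : Word) (e : Fin n) → Congruent (applyWordAt w e)
applyWordAt-cong w e = foldl-cong _ (λ l → applyLetter-cong l e) w

dualAt-dualAt : (A B : Subset n) (D : SetSystem n) → dualAt A (dualAt B D) ≈ dualAt (B Δ A) D
dualAt-dualAt A B D Y = cong (feasible D) (sym (Δ-assoc B A Y))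

dualAt-comm : (A B : Subset n) (D : SetSystem n) → dualAt A (dualAt B D) ≈ dualAt B (dualAt A D)
dualAt-comm A B D Y = begin
  feasible D (B Δ (A Δ Y)) ≡⟨ cong (feasible D) (Δ-assoc B A Y) ⟨
  feasible D ((B Δ A) Δ Y) ≡⟨ cong (λ C → feasible D (C Δ Y)) (Δ-comm B A) ⟩
  feasible D ((A Δ B) Δ Y) ≡⟨ cong (feasible D) (Δ-assoc A B Y) ⟩
  feasible D (A Δ (B Δ Y)) ∎
  where open ≡-Reasoning

dualAt-applyLetter : (l : Letter) {e : Fin n} {X : Subset n} → lookup X e ≡ false →
                     (D : SetSystem n) → dualAt X (applyLetter l e D) ≈ applyLetter l e (dualAt X D)
dualAt-applyLetter star  {e} {X} e∉X D = dualAt-comm X (single e) D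
dualAt-applyLetter times {e} {X} e∉X D Y =
  cong₂ (λ a b → feasible D (X Δ Y) xor (a ∧ feasible D b))
        (lookup-Δ-∉ e X Y e∉X) (sym (Δ-remove-∉ e X Y e∉X))

dualAt-applyWordAt : (w : Word) {e : Fin n} {X : Subset n} → lookup X e ≡ false →
                     (D : SetSystem n) → dualAt X (applyWordAt w e D) ≈ applyWordAt w e (dualAt X D)
dualAt-applyWordAt w {e} e∉X =
  foldl-intertwine _ _ _ (λ l → applyLetter-cong l e) (λ l → dualAt-applyLetter l e∉X) w

∉-single-Δ-⊤ : (e : Fin n) → lookup (single e Δ ⊤) e ≡ false
∉-single-Δ-⊤ e = trans (lookup-zipWith _xor_ e (single e) ⊤)
  (cong₂ _xor_ ([]=⇒lookup (x∈⁅x⁆ e)) (lookup-replicate e true))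

applyWordAt-conjStar : (b : Word) (e : Fin n) (D : SetSystem n) →
  applyWordAt (conjStar b) e D ≡ dualAt (single e) (applyWordAt b e (dualAt (single e) D))
applyWordAt-conjStar b e D = foldl-++ (λ D' l → applyLetter l e D') (dualAt (single e) D) b (star ∷ [])

dual-applyWordAt-conjStar : (b : Word) (e : Fin n) (D : SetSystem n) →
  dual (applyWordAt (conjStar b) e D) ≈ applyWordAt b e (dual D)
dual-applyWordAt-conjStar {n} b e D = begin
  dual (applyWordAt (conjStar b) e D)
    ≡⟨ cong dual (applyWordAt-conjStar b e D) ⟩
  dual (dualAt ⁅e⁆ (applyWordAt b e (dualAt ⁅e⁆ D)))
    ≈⟨ dualAt-dualAt ⊤ ⁅e⁆ (applyWordAt b e (dualAt ⁅e⁆ D)) ⟩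
  dualAt E-e (applyWordAt b e (dualAt ⁅e⁆ D))
    ≈⟨ dualAt-applyWordAt b (∉-single-Δ-⊤ e) (dualAt ⁅e⁆ D) ⟩
  applyWordAt b e (dualAt E-e (dualAt ⁅e⁆ D))
    ≈⟨ applyWordAt-cong b e (dualAt-dualAt E-e ⁅e⁆ D) ⟩
  applyWordAt b e (dualAt (⁅e⁆ Δ E-e) D)
    ≡⟨ cong (λ A → applyWordAt b e (dualAt A D)) (Δ-cancelˡ ⁅e⁆ ⊤) ⟩
  applyWordAt b e (dual D)
    ∎
  where
  open SetoidReasoning (≈-setoid n)
  ⁅e⁆ E-e : Subset n
  ⁅e⁆ = single e
  E-e = single e Δ ⊤

dual-applyWord-conjStar : (b : Word) (A : Subset n) (D : SetSystem n) →
  dual (applyWord (conjStar b) A D) ≈ applyWord b A (dual D)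
dual-applyWord-conjStar b A =
  foldl-intertwine dual _ _ (applyWordAt-cong b) (dual-applyWordAt-conjStar b) (elems A)

minimum : ℕ → List ℕ → ℕ
minimum = L.foldr _⊓_

-- The same case split as in width, so that width≡spread holds by refl.
spread : List ℕ → ℕ
spread xs with minL xs
... | nothing = 0
... | just m  = maxL xs ∸ m

width≡spread : (D : SetSystem n) → width D ≡ spread (feasibleSizes D)
width≡spread D with minL (feasibleSizes D)
... | nothing = refl
... | just m  = refl

maxL-upper : ∀ {y} xs → y ∈ xs → y ≤ maxL xs
maxL-upper (x ∷ xs) (here refl) = m≤m⊔n x (maxL xs)
maxL-upper (x ∷ xs) (there p)   = ≤-trans (maxL-upper xs p) (m≤n⊔m x (maxL xs))

maxL-∈ : ∀ x xs → maxL (x ∷ xs) ∈ x ∷ xs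
maxL-∈ x [] rewrite ⊔-identityʳ x = here refl
maxL-∈ x (y ∷ ys) with ⊔-sel x (maxL (y ∷ ys))
... | inj₁ eq rewrite eq = here refl
... | inj₂ eq rewrite eq = there (maxL-∈ y ys)

maxL-unique : ∀ {y} xs → y ∈ xs → (∀ {z} → z ∈ xs → z ≤ y) → maxL xs ≡ y
maxL-unique (x ∷ xs) y∈ upper = ≤-antisym (upper (maxL-∈ x xs)) (maxL-upper (x ∷ xs) y∈)

minimum-lower : ∀ {y} x xs → y ∈ x ∷ xs → minimum x xs ≤ y
minimum-lower x []       (here refl)         = ≤-refl
minimum-lower x (z ∷ zs) (there (here refl)) = m⊓n≤m z (minimum x zs)
minimum-lower x (z ∷ zs) (here refl)         = ≤-trans (m⊓n≤n z _) (minimum-lower x zs (here refl))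
minimum-lower x (z ∷ zs) (there (there p))   = ≤-trans (m⊓n≤n z _) (minimum-lower x zs (there p))

minimum-∈ : ∀ x xs → minimum x xs ∈ x ∷ xs
minimum-∈ x [] = here refl
minimum-∈ x (z ∷ zs) with ⊓-sel z (minimum x zs)
... | inj₁ eq rewrite eq = there (here refl)
... | inj₂ eq rewrite eq with minimum-∈ x zs
...   | here p  = here p
...   | there p = there (there p)

minimum-unique : ∀ {y} x xs → y ∈ x ∷ xs → (∀ {z} → z ∈ x ∷ xs → y ≤ z) → minimum x xs ≡ y
minimum-unique x xs y∈ lower = ≤-antisym (minimum-lower x xs y∈) (lower (minimum-∈ x xs))

[o∸m]∸[o∸n]≡n∸m : ∀ {m n o} → m ≤ n → n ≤ o → (o ∸ m) ∸ (o ∸ n) ≡ n ∸ m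
[o∸m]∸[o∸n]≡n∸m {m} {n} {o} m≤n n≤o = begin
  (o ∸ m) ∸ (o ∸ n)             ≡⟨ cong (λ k → (k ∸ m) ∸ (o ∸ n)) (m∸n+n≡m n≤o) ⟨
  ((o ∸ n) + n ∸ m) ∸ (o ∸ n)   ≡⟨ cong (_∸ (o ∸ n)) (+-∸-assoc (o ∸ n) m≤n) ⟩
  ((o ∸ n) + (n ∸ m)) ∸ (o ∸ n) ≡⟨ m+n∸m≡n (o ∸ n) (n ∸ m) ⟩
  n ∸ m                         ∎
  where open ≡-Reasoning

spread-complement : ∀ n (S S' : List ℕ) → (∀ {s} → s ∈ S → s ≤ n) →
  (∀ {s'} → s' ∈ S' → ∃[ s ] s ∈ S × s' ≡ n ∸ s) → (∀ {s} → s ∈ S → n ∸ s ∈ S') →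
  spread S' ≡ spread S
spread-complement n []      []        _     _   _    = refl
spread-complement n []      (s' ∷ S') _     from _   with from (here refl)
... | _ , () , _
spread-complement n (s ∷ S) []        _     _   into with into (here refl)
... | ()
spread-complement n (s ∷ S) (s' ∷ S') bound from into =
  trans (cong₂ _∸_ max≡ min≡) ([o∸m]∸[o∸n]≡n∸m m≤M (bound (maxL-∈ s S)))
  where
  M m : ℕ
  M = maxL (s ∷ S)
  m = minimum s S
  m≤M : m ≤ M
  m≤M = ≤-trans (minimum-lower s S (here refl)) (maxL-upper (s ∷ S) (here refl))
  max≡ : maxL (s' ∷ S') ≡ n ∸ m
  max≡ = maxL-unique (s' ∷ S') (into (minimum-∈ s S)) λ z∈ → case from z∈ of λ where
    (t , t∈ , refl) → ∸-monoʳ-≤ n (minimum-lower s S t∈)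
  min≡ : minimum s' S' ≡ n ∸ M
  min≡ = minimum-unique s' S' (into (maxL-∈ s S)) λ z∈ → case from z∈ of λ where
    (t , t∈ , refl) → ∸-monoʳ-≤ n (maxL-upper (s ∷ S) t∈)

∈-allSubsets : (X : Subset n) → X ∈ allSubsets n
∈-allSubsets [] = here refl
∈-allSubsets {suc n} (true ∷ X)  = ∈-++⁺ˡ (∈-map⁺ (true ∷_) (∈-allSubsets X))
∈-allSubsets {suc n} (false ∷ X) =
  ∈-++⁺ʳ (L.map (true ∷_) (allSubsets n)) (∈-map⁺ (false ∷_) (∈-allSubsets X))

∣⊤Δp∣≡n∸∣p∣ : (X : Subset n) → ∣ ⊤ Δ X ∣ ≡ n ∸ ∣ X ∣
∣⊤Δp∣≡n∸∣p∣ []          = refl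
∣⊤Δp∣≡n∸∣p∣ (true ∷ X)  = ∣⊤Δp∣≡n∸∣p∣ X
∣⊤Δp∣≡n∸∣p∣ (false ∷ X) = trans (cong suc (∣⊤Δp∣≡n∸∣p∣ X)) (sym (+-∸-assoc 1 (∣p∣≤n X)))

feasibleSizes⁻ : (D : SetSystem n) → ∀ {s} → s ∈ feasibleSizes D →
                 ∃[ X ] s ≡ ∣ X ∣ × feasible D X ≡ true
feasibleSizes⁻ {n} D s∈
  with ∈-map∘filter⁻ ∣_∣ (λ X → feasible D X ≟ true) {xs = allSubsets n} s∈
... | X , _ , s≡ , feasibleX = X , s≡ , feasibleX

feasibleSizes⁺ : (D : SetSystem n) (X : Subset n) → feasible D X ≡ true → ∣ X ∣ ∈ feasibleSizes D
feasibleSizes⁺ D X feasibleX =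
  ∈-map∘filter⁺ ∣_∣ (λ X → feasible D X ≟ true) (X , ∈-allSubsets X , refl , feasibleX)

width-dual : (D : SetSystem n) → width (dual D) ≡ width D
width-dual {n} D = begin
  width (dual D)                  ≡⟨ width≡spread (dual D) ⟩
  spread (feasibleSizes (dual D)) ≡⟨ spread-complement n _ _ bound from into ⟩
  spread (feasibleSizes D)        ≡⟨ width≡spread D ⟨
  width D                         ∎
  where
  open ≡-Reasoning
  bound : ∀ {s} → s ∈ feasibleSizes D → s ≤ n
  bound s∈ with feasibleSizes⁻ D s∈
  ... | X , refl , _ = ∣p∣≤n X
  from : ∀ {s'} → s' ∈ feasibleSizes (dual D) → ∃[ s ] s ∈ feasibleSizes D × s' ≡ n ∸ s
  from s'∈ with feasibleSizes⁻ (dual D) s'∈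
  ... | X , refl , feasible⊤ΔX =
    ∣ ⊤ Δ X ∣ , feasibleSizes⁺ D (⊤ Δ X) feasible⊤ΔX ,
    trans (sym (m∸[m∸n]≡n (∣p∣≤n X))) (cong (n ∸_) (sym (∣⊤Δp∣≡n∸∣p∣ X)))
  into : ∀ {s} → s ∈ feasibleSizes D → n ∸ s ∈ feasibleSizes (dual D)
  into s∈ with feasibleSizes⁻ D s∈
  ... | X , refl , feasibleX = subst (_∈ feasibleSizes (dual D)) (∣⊤Δp∣≡n∸∣p∣ X)
    (feasibleSizes⁺ (dual D) (⊤ Δ X) (trans (cong (feasible D) (Δ-cancelˡ ⊤ X)) feasibleX))

width-cong : {D D' : SetSystem n} → D ≈ D' → width D ≡ width D'
width-cong {n} {D} {D'} p = begin
  width D                    ≡⟨ width≡spread D ⟩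
  spread (feasibleSizes D)   ≡⟨ cong (λ Xs → spread (L.map ∣_∣ Xs)) (filter-≐ _ _ feasible≐ (allSubsets n)) ⟩
  spread (feasibleSizes D')  ≡⟨ width≡spread D' ⟨
  width D'                   ∎
  where
  open ≡-Reasoning
  feasible≐ : (λ X → feasible D X ≡ true) ≐ (λ X → feasible D' X ≡ true)
  feasible≐ = (λ {X} f → trans (sym (p X)) f) , (λ {X} f → trans (p X) f)

partialPoly-cong : (D : SetSystem n) (w : Word) (D' : SetSystem n) (w' : Word) →
  (∀ A → width (applyWord w A D) ≡ width (applyWord w' A D')) → ∀ k →
  partialPoly D w k ≡ partialPoly D' w' k
partialPoly-cong {n} D w D' w' p k = cong L.length
  (filter-≐ _ _ ((λ {A} q → trans (sym (p A)) q) , (λ {A} q → trans (p A) q)) (allSubsets n))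

mainTheorem4 : (n : ℕ) (D : SetSystem n) (b : Word) (k : ℕ) →
    partialPoly D (conjStar b) k ≡ partialPoly (dual D) b k
mainTheorem4 n D b = partialPoly-cong D (conjStar b) (dual D) b λ A → begin
  width (applyWord (conjStar b) A D)        ≡⟨ width-dual (applyWord (conjStar b) A D) ⟨
  width (dual (applyWord (conjStar b) A D)) ≡⟨ width-cong (dual-applyWord-conjStar b A D) ⟩
  width (applyWord b A (dual D))            ∎
  where open ≡-Reasoning
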